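{- Let $0<\varepsilon<1$ and let $\mathcal{O},\mathcal{S},D,\overline{\mathcal{O}},\overline{\mathcal{S}},\bar\phi$ be as in the context. Then for each $i'\in\overline{\mathcal{O}}\cup\overline{\mathcal{S}}$, $D_{i'}\le\delta(i',\bar\phi(i'))\le(1+\varepsilon)\cdot D_{i'}$.
   Context: $(V,\delta)$ is a metric space. $\mathcal{O}$ and $\mathcal{S}$ are disjoint finite nonempty sets of centres, each located at a point of $V$; distinct centres of $\mathcal{O}$ are at positive distance, likewise for $\mathcal{S}$. For $i^*\in\mathcal{O}$, $D_{i^*}=\min_{i\in\mathcal{S}}\delta(i^*,i)$; for $i\in\mathcal{S}$, $D_i=\min_{i^*\in\mathcal{O}}\delta(i,i^*)$. Filtering: build $\overline{\mathcal{O}}$ by processing $i^*\in\mathcal{O}$ in nondecreasing order of $D_{i^*}$ (ties arbitrary), starting with $\overline{\mathcal{O}}=\emptyset$: if some already selected $\bar i\in\overline{\mathcal{O}}$ has $\delta(i^*,\bar i)\le\varepsilon D_{i^*}$, set $\eta(i^*)=\bar i$ for such $\bar i$; otherwise set $\eta(i^*)=i^*$ and add $i^*$ to $\overline{\mathcal{O}}$. $\overline{\mathcal{S}}\subseteq\mathcal{S}$ and $\eta$ on $\mathcal{S}$ are defined by the same procedure applied to $\mathcal{S}$. $\bar\phi:\overline{\mathcal{O}}\cup\overline{\mathcal{S}}\to\overline{\mathcal{O}}\cup\overline{\mathcal{S}}$ maps each $i\in\overline{\mathcal{O}}$ to a nearest centre of $\overline{\mathcal{S}}$ and each $i\in\overline{\mathcal{S}}$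 to a nearest centre of $\overline{\mathcal{O}}$ (ties arbitrary). -}

module Defs where

open import Level using (0ℓ)
open import Data.Product using (Σ; ∃; _×_; _,_)
open import Data.Sum using (_⊎_)
open import Data.List using (List; []; _∷_)
open import Data.List.Membership.Propositional using (_∈_; _∉_)
open import Data.List.Relation.Unary.Unique.Propositional using (Unique)
open import Data.List.Relation.Unary.AllPairs using (AllPairs)
open import Data.List.Relation.Binary.Permutation.Propositional using (_↭_)
open import Relation.Nullary using (¬_)
open import Relation.Binary.PropositionalEquality using (_≡_; _≢_)
import Algebra.Structures as AS
import Relation.Binary.Structures as RS

-- The real numbers, axiomatised as a complete ordered field
-- (any model is isomorphic to ℝ).  Equality is propositional.

record RealField : Set₁ where
  infixl 6 _+_
  infixl 7 _*_
  infix 4 _≤_ _<_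
  field
    ℝ   : Set
    _+_ _*_ : ℝ → ℝ → ℝ
    -_  : ℝ → ℝ
    0# 1# : ℝ
    _≤_ : ℝ → ℝ → Set
    isCommutativeRing : AS.IsCommutativeRing {A = ℝ} _≡_ _+_ _*_ -_ 0# 1#
    isTotalOrder      : RS.IsTotalOrder {A = ℝ} _≡_ _≤_
    0≢1     : 0# ≢ 1#
    inverse : ∀ x → x ≢ 0# → ∃ λ y → x * y ≡ 1#
    +-mono  : ∀ x y z → x ≤ y → x + z ≤ y + z
    *-pos   : ∀ x y → 0# ≤ x → 0# ≤ y → 0# ≤ x * y
    complete : (P : ℝ → Set) → ∃ P → (∃ λ u → ∀ x → P x → x ≤ u) →
               ∃ λ s → (∀ x → P x → x ≤ s) × (∀ u → (∀ x → P x → x ≤ u) → s ≤ u)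

  _<_ : ℝ → ℝ → Set
  x < y = (x ≤ y) × (x ≢ y)

record MetricSpace (R : RealField) : Set₁ where
  open RealField R
  field
    V : Set
    δ : V → V → ℝ
    nonneg   : ∀ x y → 0# ≤ δ x y
    zero⇒eq  : ∀ x y → δ x y ≡ 0# → x ≡ y
    eq⇒zero  : ∀ x → δ x x ≡ 0#
    sym      : ∀ x y → δ x y ≡ δ y x
    triangle : ∀ x y z → δ x z ≤ δ x y + δ y z

module Filtering {R : RealField} (M : MetricSpace R)
                 {C : Set} (loc : C → MetricSpace.V M) where
  open RealField R
  open MetricSpace M

  d : C → C → ℝ
  d a b = δ (loc a) (loc b)

  -- One run of the filtering loop.  `Run ε D η todo acc fin`:
  -- processing the centres of `todo` in order, starting with the already
  -- selected centres `acc`, ends with the selected set `fin`, and η assigns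
  -- the processed centres as the procedure prescribes.
  data Run (ε : ℝ) (D : C → ℝ) (η : C → C) : List C → List C → List C → Set where
    done  : ∀ {acc} → Run ε D η [] acc acc
    merge : ∀ {i is acc fin} (b : C) → b ∈ acc → d i b ≤ ε * D i → η i ≡ b →
            Run ε D η is acc fin → Run ε D η (i ∷ is) acc fin
    keep  : ∀ {i is acc fin} → (∀ b → b ∈ acc → ¬ (d i b ≤ ε * D i)) → η i ≡ i →
            Run ε D η is (i ∷ acc) fin → Run ε D η (i ∷ is) acc fin

  -- `Filtered ε D η L Lbar`: Lbar (with η) is an output of filtering the
  -- set L, processing it in nondecreasing order of D (ties arbitrary).
  Filtered : ℝ → (C → ℝ) → (C → C) → List C → List C → Set
  Filtered ε D η L Lbar =
    ∃ λ ord → (ord ↭ L) × AllPairs (λ a b → D a ≤ D b) ord × Run ε D η ord [] Lbar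

  IsMinOver : (C → ℝ) → List C → ℝ → Set
  IsMinOver f L m = (∃ λ j → j ∈ L × m ≡ f j) × (∀ j → j ∈ L → m ≤ f j)

  Nearest : (C → C) → C → List C → Set
  Nearest φ i T = φ i ∈ T × (∀ j → j ∈ T → d i (φ i) ≤ d i j)

-- Let i' ∈ Ō, so i' ∈ O and φ(i') ∈ S̄ ⊆ S, which gives D(i') ≤ δ(i', φ(i')).
-- For the upper bound take j ∈ S realising D(i') = δ(i', j).  Filtering places
-- η(j) in S̄ with δ(j, η(j)) ≤ ε D(j), and D(j) ≤ δ(j, i') = D(i') since i' ∈ O.
-- As φ(i') is a nearest point of S̄,
--   δ(i', φ(i')) ≤ δ(i', η(j)) ≤ δ(i', j) + δ(j, η(j)) ≤ (1 + ε) D(i').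
-- The case i' ∈ S̄ is symmetric.
module Submission where

open import Defs
open import Data.Product using (_×_; _,_; proj₁; proj₂)
open import Data.Sum using (_⊎_; inj₁; inj₂)
open import Data.List using (List; [])
open import Data.List.Membership.Propositional using (_∈_; _∉_)
open import Data.List.Relation.Unary.Any using (here; there)
open import Data.List.Relation.Unary.Unique.Propositional using (Unique)
open import Data.List.Relation.Binary.Permutation.Propositional using (↭-sym)
open import Data.List.Relation.Binary.Subset.Propositional using (_⊆_)
open import Data.List.Relation.Binary.Subset.Propositional.Properties using (⊆-reflexive-↭)
open import Relation.Binary.PropositionalEquality
  using (_≡_; _≢_; refl; sym; subst; subst₂; cong; module ≡-Reasoning)
open import Function using (id; _∘′_)
open import Relation.Binary.Bundles using (Poset)
open import Relation.Binary.Structures using (IsTotalOrder)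
open import Algebra.Bundles using (Ring)
open import Algebra.Structures using (IsCommutativeRing)
import Algebra.Properties.Group as GroupProperties
import Algebra.Properties.Ring as RingProperties
import Relation.Binary.Reasoning.PartialOrder as PosetReasoning

module OrderedFieldProperties (R : RealField) where
  open RealField R
  open IsCommutativeRing isCommutativeRing
    using (isRing; +-comm; +-identityˡ; -‿inverseʳ; distribʳ; *-identityˡ)
  open IsTotalOrder isTotalOrder using (isPartialOrder)

  ring : Ring _ _
  ring = record { isRing = isRing }

  open Ring ring using (_-_; +-group)
  open RingProperties ring using (x[y-z]≈xy-xz)
  open GroupProperties +-group using (//-rightDividesˡ)

  ≤-poset : Poset _ _ _
  ≤-poset = record { isPartialOrder = isPartialOrder }

  module ≤-Reasoning = PosetReasoning ≤-poset

  +-monoˡ-≤ : ∀ z {x y} → x ≤ y → x + z ≤ y + z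
  +-monoˡ-≤ z {x} {y} = +-mono x y z

  +-monoʳ-≤ : ∀ z {x y} → x ≤ y → z + x ≤ z + y
  +-monoʳ-≤ z {x} {y} x≤y = subst₂ _≤_ (+-comm x z) (+-comm y z) (+-monoˡ-≤ z x≤y)

  x≤y⇒0≤y-x : ∀ {x y} → x ≤ y → 0# ≤ y - x
  x≤y⇒0≤y-x {x} {y} x≤y = subst (_≤ y - x) (-‿inverseʳ x) (+-monoˡ-≤ (- x) x≤y)

  *-monoʳ-≤-nonNeg : ∀ {e} → 0# ≤ e → ∀ {x y} → x ≤ y → e * x ≤ e * y
  *-monoʳ-≤-nonNeg {e} 0≤e {x} {y} x≤y = begin
    e * x                    ≡⟨ sym (+-identityˡ (e * x)) ⟩
    0# + e * x               ≤⟨ +-monoˡ-≤ (e * x) 0≤ey-ex ⟩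
    (e * y - e * x) + e * x  ≡⟨ //-rightDividesˡ (e * x) (e * y) ⟩
    e * y                    ∎
    where
    open ≤-Reasoning
    0≤ey-ex : 0# ≤ e * y - e * x
    0≤ey-ex = subst (0# ≤_) (x[y-z]≈xy-xz e y x) (*-pos e (y - x) 0≤e (x≤y⇒0≤y-x x≤y))

  x+ex≡[1+e]x : ∀ e x → x + e * x ≡ (1# + e) * x
  x+ex≡[1+e]x e x = sym (begin
    (1# + e) * x     ≡⟨ distribʳ x 1# e ⟩
    1# * x + e * x   ≡⟨ cong (_+ e * x) (*-identityˡ x) ⟩
    x + e * x        ∎)
    where open ≡-Reasoning

module FilteringProperties {R : RealField} (M : MetricSpace R)
                           {C : Set} (loc : C → MetricSpace.V M) where
  open RealField R
  open MetricSpace M renaming (sym to δ-sym)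
  open Filtering M loc
  open OrderedFieldProperties R

  IsMinOver-nonNeg : ∀ {i T m} → IsMinOver (d i) T m → 0# ≤ m
  IsMinOver-nonNeg {i} ((j , _ , m≡dij) , _) = subst (0# ≤_) (sym m≡dij) (nonneg (loc i) (loc j))

  module _ {ε : ℝ} {D : C → ℝ} {η : C → C} where

    Represented : List C → C → Set
    Represented Lbar j = η j ∈ Lbar × d j (η j) ≤ ε * D j

    Run-acc⊆fin : ∀ {todo acc fin} → Run ε D η todo acc fin → acc ⊆ fin
    Run-acc⊆fin done              = id
    Run-acc⊆fin (merge _ _ _ _ r) = Run-acc⊆fin r
    Run-acc⊆fin (keep _ _ r)      = Run-acc⊆fin r ∘′ there

    ∈-Run-fin⁻ : ∀ {todo acc fin} → Run ε D η todo acc fin →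
                 ∀ {x} → x ∈ fin → x ∈ acc ⊎ x ∈ todo
    ∈-Run-fin⁻ done x∈fin = inj₁ x∈fin
    ∈-Run-fin⁻ (merge _ _ _ _ r) x∈fin with ∈-Run-fin⁻ r x∈fin
    ... | inj₁ x∈acc  = inj₁ x∈acc
    ... | inj₂ x∈todo = inj₂ (there x∈todo)
    ∈-Run-fin⁻ (keep _ _ r) x∈fin with ∈-Run-fin⁻ r x∈fin
    ... | inj₁ (here refl)   = inj₂ (here refl)
    ... | inj₁ (there x∈acc) = inj₁ x∈acc
    ... | inj₂ x∈todo        = inj₂ (there x∈todo)

    -- A kept centre represents itself at distance 0, which needs ε D(j) ≥ 0.
    Run-represented : 0# ≤ ε → ∀ {todo acc fin} → Run ε D η todo acc fin →
                      (∀ j → j ∈ todo → 0# ≤ D j) → ∀ j → j ∈ todo → Represented fin j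
    Run-represented 0≤ε (merge b b∈acc close refl r) _ j (here refl) =
      Run-acc⊆fin r b∈acc , close
    Run-represented 0≤ε (keep _ ηj≡j r) D≥0 j (here refl) rewrite ηj≡j =
      Run-acc⊆fin r (here refl) ,
      subst (_≤ ε * D j) (sym (eq⇒zero (loc j))) (*-pos ε (D j) 0≤ε (D≥0 j (here refl)))
    Run-represented 0≤ε (merge _ _ _ _ r) D≥0 j (there j∈) =
      Run-represented 0≤ε r (λ k → D≥0 k ∘′ there) j j∈
    Run-represented 0≤ε (keep _ _ r) D≥0 j (there j∈) =
      Run-represented 0≤ε r (λ k → D≥0 k ∘′ there) j j∈

    Filtered-⊆ : ∀ {L Lbar} → Filtered ε D η L Lbar → Lbar ⊆ L
    Filtered-⊆ (ord , ord↭L , _ , r) x∈Lbar with ∈-Run-fin⁻ r x∈Lbar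
    ... | inj₂ x∈ord = ⊆-reflexive-↭ ord↭L x∈ord

    Filtered-represented : 0# ≤ ε → ∀ {L Lbar} → Filtered ε D η L Lbar →
                           (∀ j → j ∈ L → 0# ≤ D j) → ∀ j → j ∈ L → Represented Lbar j
    Filtered-represented 0≤ε (ord , ord↭L , _ , r) D≥0 j j∈L =
      Run-represented 0≤ε r (λ k → D≥0 k ∘′ ⊆-reflexive-↭ ord↭L) j
                      (⊆-reflexive-↭ (↭-sym ord↭L) j∈L)

    module _ {A B : List C}
             (minA : ∀ i → i ∈ A → IsMinOver (d i) B (D i))
             (minB : ∀ i → i ∈ B → IsMinOver (d i) A (D i)) where

      min-≤-nearest : ∀ {Bbar} → Bbar ⊆ B → ∀ φ {i} → i ∈ A → Nearest φ i Bbar →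
                      D i ≤ d i (φ i)
      min-≤-nearest Bbar⊆B φ {i} i∈A (φi∈Bbar , _) = proj₂ (minA i i∈A) (φ i) (Bbar⊆B φi∈Bbar)

      nearest-filtered-≤ : 0# ≤ ε → ∀ {Bbar} → Filtered ε D η B Bbar →
                           ∀ φ {i} → i ∈ A → Nearest φ i Bbar → d i (φ i) ≤ (1# + ε) * D i
      nearest-filtered-≤ 0≤ε {Bbar} filtB φ {i} i∈A (_ , nearest)
        with proj₁ (minA i i∈A)
      ... | j , j∈B , Di≡dij = begin
        d i (φ i)           ≤⟨ nearest (η j) ηj∈Bbar ⟩
        d i (η j)           ≤⟨ triangle (loc i) (loc j) (loc (η j)) ⟩
        d i j + d j (η j)   ≡⟨ cong (_+ d j (η j)) (sym Di≡dij) ⟩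
        D i + d j (η j)     ≤⟨ +-monoʳ-≤ (D i) dj-ηj≤εDi ⟩
        D i + ε * D i       ≡⟨ x+ex≡[1+e]x ε (D i) ⟩
        (1# + ε) * D i      ∎
        where
        open ≤-Reasoning
        D≥0 : ∀ k → k ∈ B → 0# ≤ D k
        D≥0 k k∈B = IsMinOver-nonNeg (minB k k∈B)
        ηj∈Bbar : η j ∈ Bbar
        ηj∈Bbar = proj₁ (Filtered-represented 0≤ε filtB D≥0 j j∈B)
        Dj≤Di : D j ≤ D i
        Dj≤Di = begin
          D j    ≤⟨ proj₂ (minB j j∈B) i i∈A ⟩
          d j i  ≡⟨ δ-sym (loc j) (loc i) ⟩
          d i j  ≡⟨ sym Di≡dij ⟩
          D i    ∎
        dj-ηj≤εDi : d j (η j) ≤ ε * D i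
        dj-ηj≤εDi = begin
          d j (η j)  ≤⟨ proj₂ (Filtered-represented 0≤ε filtB D≥0 j j∈B) ⟩
          ε * D j    ≤⟨ *-monoʳ-≤-nonNeg 0≤ε Dj≤Di ⟩
          ε * D i    ∎

      nearest-filtered-bounds : 0# ≤ ε → ∀ {Abar Bbar} →
        Filtered ε D η A Abar → Filtered ε D η B Bbar →
        ∀ φ → (∀ i → i ∈ Abar → Nearest φ i Bbar) →
        ∀ i → i ∈ Abar → D i ≤ d i (φ i) × d i (φ i) ≤ (1# + ε) * D i
      nearest-filtered-bounds 0≤ε filtA filtB φ nearest i i∈Abar =
        min-≤-nearest (Filtered-⊆ filtB) φ i∈A (nearest i i∈Abar) ,
        nearest-filtered-≤ 0≤ε filtB φ i∈A (nearest i i∈Abar)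
        where
        i∈A : i ∈ A
        i∈A = Filtered-⊆ filtA i∈Abar

lemma2 : (R : RealField) (M : MetricSpace R) (C : Set) (loc : C → MetricSpace.V M)
    (O S : List C) →
    let open RealField R
        open MetricSpace M
        open Filtering M loc
    in Unique O → Unique S → O ≢ [] → S ≢ [] →
       (∀ c → c ∈ O → c ∉ S) →
       (∀ a b → a ∈ O → b ∈ O → a ≢ b → 0# < d a b) →
       (∀ a b → a ∈ S → b ∈ S → a ≢ b → 0# < d a b) →
       (ε : ℝ) → 0# < ε → ε < 1# →
       (D : C → ℝ) →
       (∀ i → i ∈ O → IsMinOver (d i) S (D i)) →
       (∀ i → i ∈ S → IsMinOver (d i) O (D i)) →
       (η : C → C) (Obar Sbar : List C) →
       Filtered ε D η O Obar → Filtered ε D η S Sbar →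
       (φ : C → C) →
       (∀ i → i ∈ Obar → Nearest φ i Sbar) →
       (∀ i → i ∈ Sbar → Nearest φ i Obar) →
       ∀ i' → (i' ∈ Obar ⊎ i' ∈ Sbar) →
       (D i' ≤ d i' (φ i')) × (d i' (φ i') ≤ (1# + ε) * D i')
lemma2 _ M _ loc _ _ _ _ _ _ _ _ _ _ (0≤ε , _) _ _ minO minS _ _ _ filtO filtS φ nearO _ i' (inj₁ i'∈Obar) =
  FilteringProperties.nearest-filtered-bounds M loc minO minS 0≤ε filtO filtS φ nearO i' i'∈Obar
lemma2 _ M _ loc _ _ _ _ _ _ _ _ _ _ (0≤ε , _) _ _ minO minS _ _ _ filtO filtS φ _ nearS i' (inj₂ i'∈Sbar) =
  FilteringProperties.nearest-filtered-bounds M loc minS minO 0≤ε filtS filtO φ nearS i' i'∈Sbar
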